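{- Let $\varphi$ be a $\mathbb{BST}$-conjunction, $\psi$ a conjunction of atoms of the form $x=\{y\}$, $x=\{y\}$ a conjunct of $\psi$, and $M$ a set assignment satisfying $\varphi\wedge\Xi^\psi_\varphi$ such that $My\notin Mv$ for every $v\in\mathrm{Vars}(\varphi\wedge\psi)$. Define $M_{x,y}$ by $M_{x,y}v = Mv$ if $Mx\cap Mv=\emptyset$, $M_{x,y}v=(Mv\setminus Mx)\cup\{My\}$ otherwise, for $v\in\mathrm{Vars}(\varphi\wedge\psi)$, and $M_{x,y}\tilde v = M\tilde v$ for the auxiliary variables. Then for all $u,v\in\mathrm{Vars}(\varphi\wedge\psi)$: $Mu\cap Mv=\emptyset$ if and only if $M_{x,y}u\cap M_{x,y}v=\emptyset$.
   Context: Set variables range over the von Neumann universe of well-founded sets. A $\mathbb{BST}$-conjunction is a conjunction of literals of the forms $u=v\setminus w$ and $u\neq v\setminus w$. $\mathrm{Vars}(\varphi\wedge\psi)$ is the set of variables occurring in $\varphi\wedge\psi$; for each $v$ in it a new distinct auxiliary variable $\tilde v$ is introduced. $\Xi^\psi_\varphi$ is the conjunction of: (i) $x\not\subseteq y$ for each conjunct $x=\{y\}$ of $\psi$; (ii) $(y=y'\leftrightarrow x=x')$ for each pair of conjuncts $x=\{y\}$, $x'=\{y'\}$ of $\psi$; (iii) $(x\cap v\neq\emptyset\to x\subseteq v)$ for each conjunct $x=\{y\}$ of $\psi$ and each $v\in\mathrm{Vars}(\varphi\wedge\psi)$; (iv) $(x\cap v\neq\emptyset\to\tilde y\subsetneq\tilde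 v)$ for each conjunct $x=\{y\}$ of $\psi$ and $v\in\mathrm{Vars}(\varphi\wedge\psi)$; (v) $(x=y\to\tilde x=\tilde y)$ for all $x,y\in\mathrm{Vars}(\varphi\wedge\psi)$. -}

module Defs where

open import Data.Nat using (ℕ)
open import Data.Product using (Σ; _×_; _,_; proj₁; proj₂)
open import Data.Sum using (_⊎_; inj₁; inj₂; [_,_])
open import Data.Unit using (⊤)
open import Data.Empty using (⊥; ⊥-elim)
open import Data.List using (List)
open import Data.List.Relation.Unary.Any using (Any)
open import Data.List.Relation.Unary.All using (All)
open import Data.List.Membership.Propositional using () renaming (_∈_ to _∈ᴸ_)
open import Relation.Nullary using (¬_)
open import Relation.Binary.PropositionalEquality using (_≡_)
open import Function.Bundles using (_⇔_)

-- The universe of well-founded sets: Aczel's iterative sets (W-type),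
-- with extensional (bisimulation) equality.

data 𝕍 : Set₁ where
  sup : (A : Set) → (A → 𝕍) → 𝕍

infix 4 _≐_ _∈_ _∉_ _⊆_ _⊊_

_≐_ : 𝕍 → 𝕍 → Set
sup A f ≐ sup B g =
  ((a : A) → Σ B (λ b → f a ≐ g b)) × ((b : B) → Σ A (λ a → f a ≐ g b))

_∈_ : 𝕍 → 𝕍 → Set
x ∈ sup A f = Σ A (λ a → x ≐ f a)

_∉_ : 𝕍 → 𝕍 → Set
x ∉ y = ¬ (x ∈ y)

_⊆_ : 𝕍 → 𝕍 → Set₁
x ⊆ y = (z : 𝕍) → z ∈ x → z ∈ y

_⊊_ : 𝕍 → 𝕍 → Set₁
x ⊊ y = (x ⊆ y) × ¬ (x ≐ y)

∅ : 𝕍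
∅ = sup ⊥ ⊥-elim

infixl 7 _∩_
infixl 6 _∪_ _∖_

_∩_ : 𝕍 → 𝕍 → 𝕍
sup A f ∩ y = sup (Σ A (λ a → f a ∈ y)) (λ p → f (proj₁ p))

_∖_ : 𝕍 → 𝕍 → 𝕍
sup A f ∖ y = sup (Σ A (λ a → f a ∉ y)) (λ p → f (proj₁ p))

_∪_ : 𝕍 → 𝕍 → 𝕍
sup A f ∪ sup B g = sup (A ⊎ B) [ f , g ]

⁅_⁆ : 𝕍 → 𝕍
⁅ a ⁆ = sup ⊤ (λ _ → a)

Var : Set
Var = ℕ

-- BST literals:  eqDiff u v w  is  u = v ∖ w ;  neqDiff u v w  is  u ≠ v ∖ w
data Lit : Set where
  eqDiff  : Var → Var → Var → Lit
  neqDiff : Var → Var → Var → Lit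

BSTConj : Set
BSTConj = List Lit

-- A conjunction of atoms x = {y}; the pair (x , y) stands for x = {y}.
SingConj : Set
SingConj = List (Var × Var)

-- Symbols: original variables and the auxiliary copies ṽ = aux v.
data Sym : Set where
  var : Var → Sym
  aux : Var → Sym

Assignment : Set₁
Assignment = Sym → 𝕍

OccLit : Var → Lit → Set
OccLit v (eqDiff a b c)  = (v ≡ a) ⊎ (v ≡ b) ⊎ (v ≡ c)
OccLit v (neqDiff a b c) = (v ≡ a) ⊎ (v ≡ b) ⊎ (v ≡ c)

OccSing : Var → Var × Var → Set
OccSing v (x , y) = (v ≡ x) ⊎ (v ≡ y)

InVars : BSTConj → SingConj → Var → Set
InVars φ ψ v = Any (OccLit v) φ ⊎ Any (OccSing v) ψ

SatLit : Assignment → Lit → Set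
SatLit M (eqDiff u v w)  = M (var u) ≐ M (var v) ∖ M (var w)
SatLit M (neqDiff u v w) = ¬ (M (var u) ≐ M (var v) ∖ M (var w))

Sat : Assignment → BSTConj → Set
Sat M φ = All (SatLit M) φ

record SatΞ (M : Assignment) (φ : BSTConj) (ψ : SingConj) : Set₁ where
  field
    ξ-i   : ∀ {x y} → (x , y) ∈ᴸ ψ → ¬ (M (var x) ⊆ M (var y))
    ξ-ii  : ∀ {x y x′ y′} → (x , y) ∈ᴸ ψ → (x′ , y′) ∈ᴸ ψ →
            (M (var y) ≐ M (var y′)) ⇔ (M (var x) ≐ M (var x′))
    ξ-iii : ∀ {x y v} → (x , y) ∈ᴸ ψ → InVars φ ψ v →
            ¬ (M (var x) ∩ M (var v) ≐ ∅) → M (var x) ⊆ M (var v)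
    ξ-iv  : ∀ {x y v} → (x , y) ∈ᴸ ψ → InVars φ ψ v →
            ¬ (M (var x) ∩ M (var v) ≐ ∅) → M (aux y) ⊊ M (aux v)
    ξ-v   : ∀ {x y} → InVars φ ψ x → InVars φ ψ y →
            M (var x) ≐ M (var y) → M (aux x) ≐ M (aux y)

-- M′ is (a realisation of) M_{x,y}: specified pointwise, up to ≐
record IsMxy (φ : BSTConj) (ψ : SingConj) (M : Assignment) (x y : Var)
             (M′ : Assignment) : Set₁ where
  field
    disj    : ∀ v → InVars φ ψ v → M (var x) ∩ M (var v) ≐ ∅ →
              M′ (var v) ≐ M (var v)
    nondisj : ∀ v → InVars φ ψ v → ¬ (M (var x) ∩ M (var v) ≐ ∅) →
              M′ (var v) ≐ (M (var v) ∖ M (var x)) ∪ ⁅ M (var y) ⁆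
    auxs    : ∀ v → InVars φ ψ v → M′ (aux v) ≐ M (aux v)

-- Replacing the block M x by the single fresh point M y inside every set that meets M x
-- cannot create an intersection: the untouched sets avoid M x and never contain M y.
-- Nor can it destroy one: by (iii) a set meeting M x contains all of M x, so two
-- such sets already meet in M x, while after the replacement they share M y.
-- Whether a set meets M x is not decidable constructively, but disjointness is a
-- negative statement, so the case split can be made under a double negation.
module Submission where

open import Defs
open import Data.Product using (_,_; proj₁)
open import Data.Sum using (inj₁; inj₂)
open import Data.Unit using (tt)
open import Data.Empty using (⊥-elim)
open import Data.List.Membership.Propositional using () renaming (_∈_ to _∈ᴸ_)
open import Function.Base using (_∘_)
open import Function.Bundles using (_⇔_; mk⇔; Equivalence)
open import Function.Construct.Symmetry using (⇔-sym)
open import Function.Construct.Composition using (_⇔-∘_)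
open import Relation.Nullary using (¬_; Dec; yes; no)
open import Relation.Nullary.Negation.Core using (Stable; ¬¬-map)
open import Relation.Nullary.Decidable.Core using (¬¬-excluded-middle)

≐-refl : ∀ a → a ≐ a
≐-refl (sup A f) = (λ i → i , ≐-refl (f i)) , (λ i → i , ≐-refl (f i))

≐-sym : ∀ {a b} → a ≐ b → b ≐ a
≐-sym {sup A f} {sup B g} (f⊆g , g⊆f) =
  (λ j → let i , e = g⊆f j in i , ≐-sym e) ,
  (λ i → let j , e = f⊆g i in j , ≐-sym e)

≐-trans : ∀ {a b c} → a ≐ b → b ≐ c → a ≐ c
≐-trans {sup A f} {sup B g} {sup C h} (f⊆g , g⊆f) (g⊆h , h⊆g) =
  (λ i → let j , e = f⊆g i ; k , e′ = g⊆h j in k , ≐-trans e e′) ,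
  (λ k → let j , e′ = h⊆g k ; i , e = g⊆f j in i , ≐-trans e e′)

∈-respʳ-≐ : ∀ {a b c} → b ≐ c → a ∈ b → a ∈ c
∈-respʳ-≐ {b = sup B g} {sup C h} (g⊆h , _) (j , e) =
  let k , e′ = g⊆h j in k , ≐-trans e e′

∈-respˡ-≐ : ∀ {a b c} → a ≐ b → a ∈ c → b ∈ c
∈-respˡ-≐ {c = sup C h} a≐b (k , e) = k , ≐-trans (≐-sym a≐b) e

∈-⁅⁆ : ∀ a → a ∈ ⁅ a ⁆
∈-⁅⁆ a = tt , ≐-refl a

∪-introˡ : ∀ {z a b} → z ∈ a → z ∈ a ∪ b
∪-introˡ {a = sup A f} {sup B g} (i , e) = inj₁ i , e

∪-introʳ : ∀ {z a b} → z ∈ b → z ∈ a ∪ b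
∪-introʳ {a = sup A f} {sup B g} (j , e) = inj₂ j , e

∪-elim : ∀ {z a b} {ℓ} {P : Set ℓ} → (z ∈ a → P) → (z ∈ b → P) → z ∈ a ∪ b → P
∪-elim {a = sup A f} {sup B g} k _ (inj₁ i , e) = k (i , e)
∪-elim {a = sup A f} {sup B g} _ k (inj₂ j , e) = k (j , e)

∖-intro : ∀ {z a b} → z ∈ a → z ∉ b → z ∈ a ∖ b
∖-intro {a = sup A f} (i , e) z∉b = (i , z∉b ∘ ∈-respˡ-≐ (≐-sym e)) , e

∖-elimˡ : ∀ {z a b} → z ∈ a ∖ b → z ∈ a
∖-elimˡ {a = sup A f} ((i , _) , e) = i , e

Disjoint : 𝕍 → 𝕍 → Set₁
Disjoint a b = ∀ z → z ∈ a → z ∉ b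

Disjoint-sym : ∀ {a b} → Disjoint a b → Disjoint b a
Disjoint-sym a#b z z∈b z∈a = a#b z z∈a z∈b

Disjoint-stable : ∀ {a b} → Stable (Disjoint a b)
Disjoint-stable ¬¬a#b z z∈a z∈b = ¬¬a#b (λ a#b → a#b z z∈a z∈b)

Disjoint-resp-≐ : ∀ {a a′ b b′} → a ≐ a′ → b ≐ b′ → Disjoint a b → Disjoint a′ b′
Disjoint-resp-≐ a≐a′ b≐b′ a#b z z∈a′ z∈b′ =
  a#b z (∈-respʳ-≐ (≐-sym a≐a′) z∈a′) (∈-respʳ-≐ (≐-sym b≐b′) z∈b′)

∩≐∅⇔Disjoint : ∀ {a b} → (a ∩ b ≐ ∅) ⇔ Disjoint a b
∩≐∅⇔Disjoint {sup A f} {b} = mk⇔ to from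
  where
  to : sup A f ∩ b ≐ ∅ → Disjoint (sup A f) b
  to (a∩b⊆∅ , _) z (i , e) z∈b = proj₁ (a∩b⊆∅ (i , ∈-respˡ-≐ e z∈b))
  from : Disjoint (sup A f) b → sup A f ∩ b ≐ ∅
  from a#b = (λ (i , fi∈b) → ⊥-elim (a#b (f i) (i , ≐-refl (f i)) fi∈b)) , λ ()

module Collapse (X Y : 𝕍) where

  -- A′ is the image of A under M_{x,y}, with X = M x and Y = M y, together with
  -- the facts about A that the assignment provides in each case.
  data Collapsed (A A′ : 𝕍) : Set₁ where
    untouched : Disjoint X A → Y ∉ A → A′ ≐ A → Collapsed A A′
    collapsed : ¬ Disjoint X A → X ⊆ A → A′ ≐ (A ∖ X) ∪ ⁅ Y ⁆ → Collapsed A A′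

  meets-⊆-¬Disjoint : ∀ {A B} → ¬ Disjoint X A → X ⊆ B → ¬ Disjoint A B
  meets-⊆-¬Disjoint X∦A X⊆B A#B = X∦A (λ z z∈X z∈A → A#B z z∈A (X⊆B z z∈X))

  Disjoint-collapseˡ : ∀ {A B} → Y ∉ B → Disjoint A B → Disjoint ((A ∖ X) ∪ ⁅ Y ⁆) B
  Disjoint-collapseˡ Y∉B A#B z =
    ∪-elim (A#B z ∘ ∖-elimˡ) (λ (_ , z≐Y) → Y∉B ∘ ∈-respˡ-≐ z≐Y)

  Disjoint-uncollapseˡ : ∀ {A B} → Disjoint X B → Disjoint ((A ∖ X) ∪ ⁅ Y ⁆) B → Disjoint A B
  Disjoint-uncollapseˡ X#B A′#B z z∈A z∈B =
    A′#B z (∪-introˡ (∖-intro z∈A (λ z∈X → X#B z z∈X z∈B))) z∈B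

  collapsed-¬Disjoint : ∀ {A B} → ¬ Disjoint ((A ∖ X) ∪ ⁅ Y ⁆) ((B ∖ X) ∪ ⁅ Y ⁆)
  collapsed-¬Disjoint {A} {B} A′#B′ =
    A′#B′ Y (∪-introʳ {a = A ∖ X} (∈-⁅⁆ Y)) (∪-introʳ {a = B ∖ X} (∈-⁅⁆ Y))

  Collapsed-Disjoint⇔ : ∀ {A A′ B B′} → Collapsed A A′ → Collapsed B B′ →
                        Disjoint A B ⇔ Disjoint A′ B′
  Collapsed-Disjoint⇔ cA cB = mk⇔ (to cA cB) (from cA cB)
    where
    to : ∀ {A A′ B B′} → Collapsed A A′ → Collapsed B B′ → Disjoint A B → Disjoint A′ B′
    to (untouched _ _ eA) (untouched _ _ eB) = Disjoint-resp-≐ (≐-sym eA) (≐-sym eB)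
    to (collapsed X∦A _ _) (collapsed _ X⊆B _) A#B = ⊥-elim (meets-⊆-¬Disjoint X∦A X⊆B A#B)
    to (collapsed _ _ eA) (untouched _ Y∉B eB) =
      Disjoint-resp-≐ (≐-sym eA) (≐-sym eB) ∘ Disjoint-collapseˡ Y∉B
    to (untouched _ Y∉A eA) (collapsed _ _ eB) =
      Disjoint-sym ∘ Disjoint-resp-≐ (≐-sym eB) (≐-sym eA) ∘ Disjoint-collapseˡ Y∉A ∘ Disjoint-sym

    from : ∀ {A A′ B B′} → Collapsed A A′ → Collapsed B B′ → Disjoint A′ B′ → Disjoint A B
    from (untouched _ _ eA) (untouched _ _ eB) = Disjoint-resp-≐ eA eB
    from (collapsed _ _ eA) (collapsed _ _ eB) A′#B′ =
      ⊥-elim (collapsed-¬Disjoint (Disjoint-resp-≐ eA eB A′#B′))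
    from (collapsed _ _ eA) (untouched X#B _ eB) = Disjoint-uncollapseˡ X#B ∘ Disjoint-resp-≐ eA eB
    from (untouched X#A _ eA) (collapsed _ _ eB) =
      Disjoint-sym ∘ Disjoint-uncollapseˡ X#A ∘ Disjoint-resp-≐ eB eA ∘ Disjoint-sym

  ¬¬Collapsed-Disjoint⇔ : ∀ {A A′ B B′} → ¬ ¬ Collapsed A A′ → ¬ ¬ Collapsed B B′ →
                          Disjoint A B ⇔ Disjoint A′ B′
  ¬¬Collapsed-Disjoint⇔ ¬¬cA ¬¬cB = mk⇔
    (λ A#B → Disjoint-stable λ k → ¬¬cA λ cA → ¬¬cB λ cB →
      k (Equivalence.to (Collapsed-Disjoint⇔ cA cB) A#B))
    (λ A′#B′ → Disjoint-stable λ k → ¬¬cA λ cA → ¬¬cB λ cB →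
      k (Equivalence.from (Collapsed-Disjoint⇔ cA cB) A′#B′))

lemma7 : (φ : BSTConj) (ψ : SingConj) (x y : Var) → (x , y) ∈ᴸ ψ →
    (M : Assignment) → Sat M φ → SatΞ M φ ψ →
    (∀ v → InVars φ ψ v → M (var y) ∉ M (var v)) →
    (M′ : Assignment) → IsMxy φ ψ M x y M′ →
    ∀ u v → InVars φ ψ u → InVars φ ψ v →
    (M (var u) ∩ M (var v) ≐ ∅) ⇔ (M′ (var u) ∩ M′ (var v) ≐ ∅)
lemma7 φ ψ x y xy∈ψ M _ ξ y∉ M′ isMxy u v u∈ v∈ =
  ⇔-sym ∩≐∅⇔Disjoint ⇔-∘ (¬¬Collapsed-Disjoint⇔ (collapsed? u u∈) (collapsed? v v∈) ⇔-∘ ∩≐∅⇔Disjoint)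
  where
  open SatΞ ξ using (ξ-iii)
  open IsMxy isMxy
  open Collapse (M (var x)) (M (var y))

  collapsed? : ∀ w → InVars φ ψ w → ¬ ¬ Collapsed (M (var w)) (M′ (var w))
  collapsed? w w∈ = ¬¬-map case ¬¬-excluded-middle
    where
    case : Dec (M (var x) ∩ M (var w) ≐ ∅) → Collapsed (M (var w)) (M′ (var w))
    case (yes X∩w≐∅) = untouched (Equivalence.to ∩≐∅⇔Disjoint X∩w≐∅) (y∉ w w∈) (disj w w∈ X∩w≐∅)
    case (no X∩w≢∅) =
      collapsed (X∩w≢∅ ∘ Equivalence.from ∩≐∅⇔Disjoint) (ξ-iii xy∈ψ w∈ X∩w≢∅) (nondisj w w∈ X∩w≢∅)
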